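{- Let $m$ be a positive integer and $r$ an integer with $1\le r\le m$ and $\gcd(r,m)=1$. Then $\omega_r(m)\ge \frac1m$.
   Context: For an integer $r$ and prime power $q^j$ ($j\ge1$), $\omega_r(q^j)=\frac1{q^{j-1}(q-1)}$ if $r\not\equiv1\pmod{q^{\lceil j/2\rceil}}$ and $\omega_r(q^j)=\frac{q^{\lfloor j/2\rfloor+1}+q^{\lfloor j/2\rfloor}-1}{q^{j+\lfloor j/2\rfloor-1}(q^2-1)}$ if $r\equiv1\pmod{q^{\lceil j/2\rceil}}$; $\omega_r$ is extended multiplicatively in its argument, $\omega_r(m)=\prod_{q^j\parallel m}\omega_r(q^j)$. -}

module Defs where

open import Data.Nat using (ℕ; zero; suc; _+_; _*_; _∸_; _^_; ⌊_/2⌋; ⌈_/2⌉)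
open import Data.Nat.Divisibility using (_∣_; _∣?_)
open import Data.Nat.Primality using (prime?)
open import Data.Integer using (ℤ; +_; _-_; ∣_∣)
open import Data.Rational using (ℚ; _/_; 1ℚ; 0ℚ) renaming (_*_ to _*ℚ_)
open import Data.List using (List; upTo; filter; map; foldr)
open import Relation.Nullary using (Dec; yes; no; _×-dec_)

-- a / b as a rational (b = 0 gives 0; never happens for prime q)
frac : ℕ → ℕ → ℚ
frac a zero    = 0ℚ
frac a (suc b) = + a / suc b

fracℤ : ℕ → ℕ → ℕ → ℚ
fracℤ a c zero    = 0ℚ
fracℤ a c (suc b) = (+ a - + c) / suc b

-- valuation: largest j ≤ bound with q ^ j ∣ m  (for q ≥ 2, m ≥ 1, bound = m gives v_q(m))
valSearch : ℕ → ℕ → ℕ → ℕ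
valSearch q m zero      = 0
valSearch q m (suc j) with (q ^ suc j) ∣? m
... | yes _ = suc j
... | no  _ = valSearch q m j

val : ℕ → ℕ → ℕ
val q m = valSearch q m m

congOne? : (r : ℤ) (N : ℕ) → Dec (N ∣ ∣ r - + 1 ∣)
congOne? r N = N ∣? ∣ r - + 1 ∣

-- ω_r(q^j) for prime q and j ≥ 1
ωpp : ℤ → ℕ → ℕ → ℚ
ωpp r q j with congOne? r (q ^ ⌈ j /2⌉)
... | no  _ = frac 1 (q ^ (j ∸ 1) * (q ∸ 1))
... | yes _ = fracℤ (q ^ (⌊ j /2⌋ + 1) + q ^ ⌊ j /2⌋) 1
                    (q ^ (j + ⌊ j /2⌋ ∸ 1) * (q * q ∸ 1))

primeDivisors : ℕ → List ℕ
primeDivisors m = filter (λ q → prime? q ×-dec (q ∣? m)) (upTo (suc m))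

ω : ℤ → ℕ → ℚ
ω r m = foldr (λ q acc → ωpp r q (val q m) *ℚ acc) 1ℚ (primeDivisors m)

-- Whatever r is, each local factor satisfies ω_r(q^j) ≥ q^(-j): in the generic case the
-- denominator q^(j-1)(q-1) is at most q^j, and in the case r ≡ 1 the numerator exceeds
-- q^(⌊j/2⌋+1) while the denominator is below q^(j+⌊j/2⌋+1).  Hence ω_r(m) ≥ 1/∏ q^(v_q(m)),
-- and ∏ q^(v_q(m)) ≤ m because the prime powers are pairwise coprime divisors of m.
module Submission where

open import Defs
open import Data.Nat as ℕ using (ℕ; zero; suc; _+_; _*_; _∸_; _^_; _≤_; _<_; NonZero; s≤s; z≤n)
import Data.Nat.Properties as ℕP
open import Data.Nat.Divisibility using (_∣_; divides; _∣?_; ∣1⇒≡1; 1∣_; *-monoˡ-∣; ∣-trans; ∣⇒≤)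
open import Data.Nat.GCD using (gcd)
open import Data.Nat.Coprimality as Coprime using (Coprime; coprime-divisor)
open import Data.Nat.Primality using (Prime; prime?; prime⇒irreducible; ¬prime[1]; prime⇒nonZero; prime⇒nonTrivial)
open import Data.Nat.ListAction using (product)
open import Data.Nat.Tactic.RingSolver using (solve-∀)
open import Data.Integer as ℤ using (+_)
import Data.Integer.Properties as ℤP
open import Data.Rational as ℚ using (ℚ; _/_) renaming (_≤_ to _≤ℚ_; _*_ to _*ℚ_)
import Data.Rational.Properties as ℚP
open import Data.Rational.Unnormalised as ℚᵘ using (mkℚᵘ)
import Data.Rational.Unnormalised.Properties as ℚᵘP
open import Data.List using ([]; _∷_; map; foldr; upTo)
open import Data.List.Relation.Unary.All as All using (All; []; _∷_)
import Data.List.Relation.Unary.All.Properties as AllP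
open import Data.List.Relation.Unary.AllPairs using (AllPairs; []; _∷_)
import Data.List.Relation.Unary.Unique.Propositional.Properties as UniqueP
open import Data.Product using (_×_; _,_; proj₁)
open import Data.Sum using (inj₁; inj₂)
open import Data.Empty using (⊥-elim)
open import Relation.Nullary using (yes; no; _×-dec_)
open import Relation.Binary.PropositionalEquality using (_≡_; _≢_; refl; sym; cong; subst; subst₂; module ≡-Reasoning)

frac-mono : ∀ a {b} c {d} → 0 < b → 0 < d → a * d ≤ c * b → frac a b ≤ℚ frac c d
frac-mono a {suc b} c {suc d} _ _ ad≤cb = ℚP.toℚᵘ-cancel-≤
  (ℚᵘP.≤-respˡ-≃ (ℚᵘP.≃-sym (ℚP.toℚᵘ-fromℚᵘ (mkℚᵘ (+ a) b)))
  (ℚᵘP.≤-respʳ-≃ (ℚᵘP.≃-sym (ℚP.toℚᵘ-fromℚᵘ (mkℚᵘ (+ c) d)))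
    (ℚᵘ.*≤* (subst₂ ℤ._≤_ (ℤP.pos-* a (suc d)) (ℤP.pos-* c (suc b)) (ℤ.+≤+ ad≤cb)))))

frac1≤frac : ∀ {a} c {d} → 0 < a → 0 < d → d ≤ c * a → frac 1 a ≤ℚ frac c d
frac1≤frac c 0<a 0<d d≤ca = frac-mono 1 c 0<a 0<d (subst (_≤ c * _) (sym (ℕP.*-identityˡ _)) d≤ca)

frac1-anti : ∀ {a d} → 0 < a → 0 < d → d ≤ a → frac 1 a ≤ℚ frac 1 d
frac1-anti {a} 0<a 0<d d≤a = frac1≤frac 1 0<a 0<d (subst (_ ≤_) (sym (ℕP.*-identityˡ a)) d≤a)

frac1-* : ∀ {a b} → 0 < a → 0 < b → frac 1 (a * b) ≡ frac 1 a *ℚ frac 1 b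
frac1-* {suc a} {suc b} _ _ = ℚP.toℚᵘ-injective (ℚᵘP.≃-trans
  (ℚP.toℚᵘ-fromℚᵘ (mkℚᵘ (+ 1) (b + a * suc b)))
  (ℚᵘP.≃-sym (ℚᵘP.≃-trans (ℚP.toℚᵘ-homo-* (frac 1 (suc a)) (frac 1 (suc b)))
    (ℚᵘP.*-cong (ℚP.toℚᵘ-fromℚᵘ (mkℚᵘ (+ 1) a)) (ℚP.toℚᵘ-fromℚᵘ (mkℚᵘ (+ 1) b))))))

frac-nonNeg : ∀ a b → ℚ.NonNegative (frac a b)
frac-nonNeg a zero    = _
frac-nonNeg a (suc b) = ℚP.normalize-nonNeg a (suc b)

product-pos : ∀ (d : ℕ → ℕ) L → All (λ q → 0 < d q) L → 0 < product (map d L)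
product-pos d []      []           = s≤s z≤n
product-pos d (q ∷ L) (0<dq ∷ 0<d) = ℕP.*-mono-≤ 0<dq (product-pos d L 0<d)

1/product≤foldr : ∀ (d : ℕ → ℕ) (w : ℕ → ℚ) L → All (λ q → 0 < d q) L →
                  All (λ q → frac 1 (d q) ≤ℚ w q) L →
                  frac 1 (product (map d L)) ≤ℚ foldr (λ q acc → w q *ℚ acc) ℚ.1ℚ L
1/product≤foldr d w []      _            _           = ℚP.≤-refl
1/product≤foldr d w (q ∷ L) (0<dq ∷ 0<d) (dq≤wq ∷ d≤w) = begin
  frac 1 (d q * ∏d)                          ≡⟨ frac1-* 0<dq (product-pos d L 0<d) ⟩
  frac 1 (d q) *ℚ frac 1 ∏d                  ≤⟨ ℚP.*-monoʳ-≤-nonNeg (frac 1 ∏d) {{frac-nonNeg 1 ∏d}} dq≤wq ⟩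
  w q *ℚ frac 1 ∏d                           ≤⟨ ℚP.*-monoˡ-≤-nonNeg (w q) {{wq-nonNeg}} (1/product≤foldr d w L 0<d d≤w) ⟩
  w q *ℚ foldr (λ q acc → w q *ℚ acc) ℚ.1ℚ L ∎
  where
  open ℚP.≤-Reasoning
  ∏d = product (map d L)
  wq-nonNeg : ℚ.NonNegative (w q)
  wq-nonNeg = ℚ.nonNegative (ℚP.≤-trans (ℚP.nonNegative⁻¹ _ {{frac-nonNeg 1 (d q)}}) dq≤wq)

coprime-* : ∀ {a b c} → Coprime a b → Coprime a c → Coprime a (b * c)
coprime-* {a} {b} {c} a⊥b a⊥c {d} (d∣a , d∣bc) = a⊥c (d∣a , coprime-divisor d⊥b d∣bc)
  where
  d⊥b : Coprime d b
  d⊥b (e∣d , e∣b) = a⊥b (∣-trans e∣d d∣a , e∣b)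

coprime-^ : ∀ {a b} n → Coprime a b → Coprime a (b ^ n)
coprime-^ zero    a⊥b (_ , d∣1) = ∣1⇒≡1 d∣1
coprime-^ (suc n) a⊥b = coprime-* a⊥b (coprime-^ n a⊥b)

coprime-^-^ : ∀ {a b} m n → Coprime a b → Coprime (a ^ m) (b ^ n)
coprime-^-^ m n a⊥b = Coprime.sym (coprime-^ m (Coprime.sym (coprime-^ n a⊥b)))

prime-≢⇒coprime : ∀ {p q} → Prime p → Prime q → p ≢ q → Coprime p q
prime-≢⇒coprime {p} {q} prime-p prime-q p≢q {d} (d∣p , d∣q) with prime⇒irreducible prime-p d∣p
... | inj₁ d≡1 = d≡1
... | inj₂ refl with prime⇒irreducible prime-q d∣q
...   | inj₁ refl = ⊥-elim (¬prime[1] prime-p)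
...   | inj₂ p≡q  = ⊥-elim (p≢q p≡q)

coprime-∣⇒*∣ : ∀ {a b n} → Coprime a b → a ∣ n → b ∣ n → a * b ∣ n
coprime-∣⇒*∣ {a} {b} a⊥b a∣n (divides k refl) =
  *-monoˡ-∣ b (coprime-divisor a⊥b (subst (a ∣_) (ℕP.*-comm k b) a∣n))

product-∣ : ∀ (d : ℕ → ℕ) {n} L → All (λ q → d q ∣ n) L →
            AllPairs (λ p q → Coprime (d p) (d q)) L → product (map d L) ∣ n
product-∣ d {n} []      []          []                = 1∣ n
product-∣ d     (q ∷ L) (dq∣n ∷ d∣n) (dq⊥d ∷ pairwise) =
  coprime-∣⇒*∣ (product-coprime L dq⊥d) dq∣n (product-∣ d L d∣n pairwise)
  where
  product-coprime : ∀ L → All (λ p → Coprime (d q) (d p)) L → Coprime (d q) (product (map d L))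
  product-coprime []      []           (_ , e∣1) = ∣1⇒≡1 e∣1
  product-coprime (p ∷ L) (dq⊥dp ∷ dq⊥d) = coprime-* dq⊥dp (product-coprime L dq⊥d)

primes-pairwise-coprime : ∀ (e : ℕ → ℕ) {L} → All Prime L → AllPairs _≢_ L →
                          AllPairs (λ p q → Coprime (p ^ e p) (q ^ e q)) L
primes-pairwise-coprime e []                      []                 = []
primes-pairwise-coprime e {p ∷ L} (prime-p ∷ primes) (p≢L ∷ distinct) =
  All.zipWith p^ep⊥ (primes , p≢L) ∷ primes-pairwise-coprime e primes distinct
  where
  p^ep⊥ : ∀ {q} → Prime q × p ≢ q → Coprime (p ^ e p) (q ^ e q)
  p^ep⊥ {q} (prime-q , p≢q) = coprime-^-^ (e p) (e q) (prime-≢⇒coprime prime-p prime-q p≢q)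

valSearch-∣ : ∀ q m j → q ^ valSearch q m j ∣ m
valSearch-∣ q m zero = 1∣ m
valSearch-∣ q m (suc j) with q ^ suc j ∣? m
... | yes q^j∣m = q^j∣m
... | no  _     = valSearch-∣ q m j

valSearch-pos : ∀ q m j → q ∣ m → 0 < valSearch q m (suc j)
valSearch-pos q m j q∣m with q ^ suc j ∣? m
valSearch-pos q m j       q∣m | yes _ = s≤s z≤n
valSearch-pos q m zero    q∣m | no q¹∤m = ⊥-elim (q¹∤m (subst (_∣ m) (sym (ℕP.*-identityʳ q)) q∣m))
valSearch-pos q m (suc j) q∣m | no _    = valSearch-pos q m j q∣m

val-pos : ∀ q m .{{_ : NonZero m}} → q ∣ m → 0 < val q m
val-pos q (suc m) = valSearch-pos q (suc m) m

fracℤ-1 : ∀ a d → 0 < a → fracℤ a 1 d ≡ frac (a ∸ 1) d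
fracℤ-1 (suc a) zero    _ = refl
fracℤ-1 (suc a) (suc d) _ = refl

q^[k+f]*q²≡q^[1+f]*q^[1+k] : ∀ q k f → q ^ (k + f) * (q * q) ≡ q ^ (f + 1) * q ^ suc k
q^[k+f]*q²≡q^[1+f]*q^[1+k] q k f = begin
  q ^ (k + f) * (q * q)   ≡⟨ cong (_* (q * q)) (ℕP.^-distribˡ-+-* q k f) ⟩
  q ^ k * q ^ f * (q * q) ≡⟨ shuffle (q ^ k) (q ^ f) q ⟩
  q * q ^ f * (q * q ^ k) ≡⟨ cong (λ i → q ^ i * q ^ suc k) (ℕP.+-comm 1 f) ⟩
  q ^ (f + 1) * q ^ suc k ∎
  where
  open ≡-Reasoning
  shuffle : ∀ Q F q → Q * F * (q * q) ≡ q * F * (q * Q)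
  shuffle = solve-∀

1/q^j≤ωpp : ∀ r q j → 2 ≤ q → 0 < j → frac 1 (q ^ j) ≤ℚ ωpp r q j
1/q^j≤ωpp r q@(suc (suc _)) (suc k) (s≤s (s≤s z≤n)) _ with congOne? r (q ^ ℕ.⌈ suc k /2⌉)
... | no _  = frac1-anti (ℕP.m^n>0 q (suc k)) (ℕP.*-mono-≤ (ℕP.m^n>0 q k) (s≤s z≤n)) (begin
  q ^ k * (q ∸ 1) ≤⟨ ℕP.*-monoʳ-≤ (q ^ k) (ℕP.m∸n≤m q 1) ⟩
  q ^ k * q       ≡⟨ ℕP.*-comm (q ^ k) q ⟩
  q ^ suc k       ∎)
  where open ℕP.≤-Reasoning
... | yes _ = subst (frac 1 (q ^ suc k) ≤ℚ_) (sym (fracℤ-1 a (q ^ (k + f) * (q * q ∸ 1)) 0<a)) (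
  frac1≤frac (a ∸ 1) (ℕP.m^n>0 q (suc k)) (ℕP.*-mono-≤ (ℕP.m^n>0 q (k + f)) (s≤s z≤n)) (begin
  q ^ (k + f) * (q * q ∸ 1)               ≤⟨ ℕP.*-monoʳ-≤ (q ^ (k + f)) (ℕP.m∸n≤m (q * q) 1) ⟩
  q ^ (k + f) * (q * q)                   ≡⟨ q^[k+f]*q²≡q^[1+f]*q^[1+k] q k f ⟩
  q ^ (f + 1) * q ^ suc k                 ≤⟨ ℕP.*-monoˡ-≤ (q ^ suc k) (ℕP.m≤m+n (q ^ (f + 1)) (q ^ f ∸ 1)) ⟩
  (q ^ (f + 1) + (q ^ f ∸ 1)) * q ^ suc k ≡⟨ cong (_* q ^ suc k) (ℕP.+-∸-assoc (q ^ (f + 1)) (ℕP.m^n>0 q f)) ⟨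
  (a ∸ 1) * q ^ suc k                     ∎))
  where
  open ℕP.≤-Reasoning
  f = ℕ.⌊ suc k /2⌋
  a = q ^ (f + 1) + q ^ f
  0<a : 0 < a
  0<a = ℕP.≤-trans (ℕP.m^n>0 q f) (ℕP.m≤n+m (q ^ f) (q ^ (f + 1)))

lemma6p3 : (m r : ℕ) .{{_ : NonZero m}} → 1 ≤ r → r ≤ m → gcd r m ≡ 1 →
           (+ 1 / m) ≤ℚ ω (+ r) m
lemma6p3 m@(suc _) r _ _ _ = begin
  frac 1 m                                 ≤⟨ frac1-anti (s≤s z≤n) (product-pos d L 0<d) (∣⇒≤ ∏d∣m) ⟩
  frac 1 (product (map d L))               ≤⟨ 1/product≤foldr d (λ q → ωpp (+ r) q (val q m)) L 0<d local-bounds ⟩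
  ω (+ r) m                                ∎
  where
  open ℚP.≤-Reasoning
  L = primeDivisors m
  d : ℕ → ℕ
  d q = q ^ val q m
  prime-divisors : All (λ q → Prime q × q ∣ m) L
  prime-divisors = AllP.all-filter (λ q → prime? q ×-dec (q ∣? m)) (upTo (suc m))
  0<d : All (λ q → 0 < d q) L
  0<d = All.map (λ {q} (prime-q , _) → ℕP.m^n>0 q {{prime⇒nonZero prime-q}} (val q m)) prime-divisors
  ∏d∣m : product (map d L) ∣ m
  ∏d∣m = product-∣ d L (All.map (λ {q} _ → valSearch-∣ q m m) prime-divisors)
           (primes-pairwise-coprime (λ q → val q m) (All.map proj₁ prime-divisors)
             (UniqueP.filter⁺ (λ q → prime? q ×-dec (q ∣? m)) (UniqueP.upTo⁺ (suc m))))
  local-bounds : All (λ q → frac 1 (d q) ≤ℚ ωpp (+ r) q (val q m)) L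
  local-bounds = All.map (λ {q} (prime-q , q∣m) →
    1/q^j≤ωpp (+ r) q (val q m) (ℕ.nonTrivial⇒n>1 q {{prime⇒nonTrivial prime-q}}) (val-pos q m q∣m))
    prime-divisors
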